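{- For every positive integer $k$, $RR(\mathcal{E}(k,1)) = 4$ if $k \leq 3$, and $RR(\mathcal{E}(k,1)) = 5$ if $k \geq 4$.
   Context: For a positive integer $k$ and an integer $j > -k$, $\mathcal{E}(k,j)$ denotes the equation $x+y+kz=(k+j)w$. A $2$-coloring of $[1,N]=\{1,2,\dots,N\}$ is a map $\chi:[1,N]\to\{0,1\}$; a solution $(x,y,z,w)$ with $x,y,z,w\in[1,N]$ (not necessarily distinct) is monochromatic if $\chi(x)=\chi(y)=\chi(z)=\chi(w)$. For an equation $\mathcal{E}$, $RR(\mathcal{E})$ denotes the minimum positive integer $N$ such that every $2$-coloring of $[1,N]$ admits a monochromatic solution to $\mathcal{E}$ in $[1,N]$. -}

module Defs where

open import Data.Nat using (ℕ; suc; _≤_; _<_)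
open import Data.Integer using (ℤ; +_; -_; _+_; _*_; _>_)
open import Data.Bool using (Bool)
open import Data.Product using (_×_; ∃)
open import Relation.Binary.PropositionalEquality using (_≡_)
open import Relation.Nullary using (¬_)

-- Solutions are taken in positive integers,
-- so we state the equation in ℤ with x,y,z,w ∈ ℕ embedded.
-- Positivity of k and j > -k are carried as hypotheses where used.
E : ℕ → ℤ → ℕ → ℕ → ℕ → ℕ → Set
E k j x y z w = (+ x) + (+ y) + (+ k) * (+ z) ≡ ((+ k) + j) * (+ w)

InRange : ℕ → ℕ → Set
InRange N x = 1 ≤ x × x ≤ N

-- A 2-coloring of [1,N]: a map ℕ → Bool, of which only the values on
-- [1,N] matter.
Coloring : Set
Coloring = ℕ → Bool

HasMonoSol : ℕ → ℤ → ℕ → Coloring → Set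
HasMonoSol k j N χ =
  ∃ λ x → ∃ λ y → ∃ λ z → ∃ λ w →
    InRange N x × InRange N y × InRange N z × InRange N w ×
    E k j x y z w ×
    χ x ≡ χ w × χ y ≡ χ w × χ z ≡ χ w

Forces : ℕ → ℤ → ℕ → Set
Forces k j N = (χ : Coloring) → HasMonoSol k j N χ

IsRR : ℕ → ℤ → ℕ → Set
IsRR k j N = 1 ≤ N × Forces k j N × ((M : ℕ) → 1 ≤ M → M < N → ¬ Forces k j M)

-- The upper bounds are finite computations: two colours of [1,4] (k ≤ 3) or of
-- [1,5] (any k) always contain a monochromatic solution.  For [1,5] this is
-- Schur's theorem S(2) = 4, since a Schur triple x + y = w gives the solution
-- (x, y, w, w) of x + y + k z = (k + 1) w for every k.  The lower bounds are
-- the colourings {1,3} | {2} of [1,3] and {1,4} | {2,3} of [1,4].  Once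
-- k ≥ 8 the sides x + y and w are too small compared with k for any solution
-- in [1,4] other than z = w, x + y = w, so the Schur-free colouring
-- {1,4} | {2,3} has none; the remaining k ≤ 7 are checked directly.
module Submission where

open import Defs
open import Data.Bool using (Bool; true; false) renaming (_≟_ to _≟ᵇ_)
open import Data.Integer using (+_) renaming (_+_ to _+ℤ_; _*_ to _*ℤ_; _≟_ to _≟ℤ_)
open import Data.Integer.Properties using (pos-+; pos-*; +-injective)
open import Data.Nat using (ℕ; zero; suc; _+_; _*_; _≤_; _<_; z≤n; s≤s; _≤?_)
open import Data.Nat.Properties
  using ( ≤-trans; ≤-pred; <⇒≱; <-cmp; *-suc; *-monoʳ-≤; +-comm; +-mono-≤; +-identityʳ
        ; +-cancelʳ-≡; +-cancelʳ-≤; m≤n+m; m≤m+n; m<m+n; anyUpTo?; module ≤-Reasoning)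
open import Data.Product using (_×_; _,_; ∃; proj₂)
open import Data.Vec using (Vec; []; _∷_)
open import Function using (_∘_; _⇔_; mk⇔; Equivalence)
open import Relation.Binary.Definitions using (tri<; tri≈; tri>)
open import Relation.Binary.PropositionalEquality using (_≡_; refl; sym; trans; cong)
open import Relation.Nullary using (¬_; Dec; map′; _×-dec_; from-yes; from-no; contradiction)

open Equivalence using (to; from)

E⇔ℕ : ∀ k j x y z w → E k (+ j) x y z w ⇔ (x + y + k * z ≡ (k + j) * w)
E⇔ℕ k j x y z w = mk⇔
  (λ e → +-injective (trans lhs (trans e (sym rhs))))
  (λ e → trans (sym lhs) (trans (cong +_ e) rhs))
  where
  lhs : + (x + y + k * z) ≡ + x +ℤ + y +ℤ + k *ℤ + z
  lhs = trans (pos-+ (x + y) (k * z)) (cong (+ (x + y) +ℤ_) (pos-* k z))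
  rhs : + ((k + j) * w) ≡ (+ k +ℤ + j) *ℤ + w
  rhs = trans (pos-* (k + j) w) (cong (_*ℤ + w) (pos-+ k j))

-- E 0 (+ 1) is Schur's equation x + y = w, the fourth variable z being free.
schur⇔ : ∀ x y z w → E 0 (+ 1) x y z w ⇔ (x + y ≡ w)
schur⇔ x y z w = mk⇔
  (λ e → trans (sym (+-identityʳ (x + y))) (trans (to e⇔ e) (+-identityʳ w)))
  (λ e → from e⇔ (trans (+-identityʳ (x + y)) (trans e (sym (+-identityʳ w)))))
  where
  e⇔ : E 0 (+ 1) x y z w ⇔ (x + y + 0 ≡ w + 0)
  e⇔ = E⇔ℕ 0 1 x y z w

[k+1]*w≡w+k*w : ∀ k w → (k + 1) * w ≡ w + k * w
[k+1]*w≡w+k*w k w = cong (_* w) (+-comm k 1)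

schur-solution : ∀ k {x y w} → x + y ≡ w → x + y + k * w ≡ (k + 1) * w
schur-solution k {w = w} refl = sym ([k+1]*w≡w+k*w k w)

-- Rewritten as x + y − w = k (w − z): the left side lies strictly between −k
-- and k, so w − z = 0.
small-solution⇒schur : ∀ {k x y z w} → x + y ≤ k → w < k →
  x + y + k * z ≡ (k + 1) * w → z ≡ w × x + y ≡ w
small-solution⇒schur {k} {x} {y} {z} {w} x+y≤k w<k eq with <-cmp z w
... | tri≈ _ refl _ = refl , +-cancelʳ-≡ (k * z) (x + y) z (trans eq ([k+1]*w≡w+k*w k z))
... | tri< z<w _ _ = contradiction x+y≤k (<⇒≱ (+-cancelʳ-≤ (k * z) (suc k) (x + y) k<x+y))
  where
  open ≤-Reasoning
  k<x+y : suc k + k * z ≤ x + y + k * z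
  k<x+y = begin
    suc (k + k * z)     ≡⟨ cong suc (sym (*-suc k z)) ⟩
    suc (k * suc z)     ≤⟨ +-mono-≤ (≤-trans (s≤s z≤n) z<w) (*-monoʳ-≤ k z<w) ⟩
    w + k * w           ≡⟨ sym (trans eq ([k+1]*w≡w+k*w k w)) ⟩
    x + y + k * z       ∎
... | tri> _ _ w<z = contradiction k≤w (<⇒≱ w<k)
  where
  open ≤-Reasoning
  k≤w : k ≤ w
  k≤w = +-cancelʳ-≤ (k * w) k w (begin
    k + k * w           ≡⟨ sym (*-suc k w) ⟩
    k * suc w           ≤⟨ *-monoʳ-≤ k w<z ⟩
    k * z               ≤⟨ m≤n+m (k * z) (x + y) ⟩
    x + y + k * z       ≡⟨ trans eq ([k+1]*w≡w+k*w k w) ⟩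
    w + k * w           ∎)

hasMonoSol-local : ∀ {k j N} {χ χ′ : Coloring} → (∀ {x} → InRange N x → χ x ≡ χ′ x) →
  HasMonoSol k j N χ → HasMonoSol k j N χ′
hasMonoSol-local {N = N} {χ} {χ′} χ≗χ′ (x , y , z , w , rx , ry , rz , rw , e , cx , cy , cz) =
  x , y , z , w , rx , ry , rz , rw , e , agree rx cx , agree ry cy , agree rz cz
  where
  agree : ∀ {a} → InRange N a → χ a ≡ χ w → χ′ a ≡ χ′ w
  agree ra c = trans (sym (χ≗χ′ ra)) (trans c (χ≗χ′ rw))

hasMonoSol-mono : ∀ {k j M N χ} → M ≤ N → HasMonoSol k j M χ → HasMonoSol k j N χ
hasMonoSol-mono {M = M} {N} M≤N (x , y , z , w , rx , ry , rz , rw , rest) =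
  x , y , z , w , widen rx , widen ry , widen rz , widen rw , rest
  where
  widen : ∀ {a} → InRange M a → InRange N a
  widen (1≤a , a≤M) = 1≤a , ≤-trans a≤M M≤N

forces-mono : ∀ {k j M N} → M ≤ N → Forces k j M → Forces k j N
forces-mono {k} {j} M≤N F χ = hasMonoSol-mono {k} {j} M≤N (F χ)

isRR-intro : ∀ {k j N} → Forces k j (suc N) → ¬ Forces k j N → IsRR k j (suc N)
isRR-intro {k} {j} F ¬F = s≤s z≤n , F , λ M _ M<1+N F′ → ¬F (forces-mono {k} {j} (≤-pred M<1+N) F′)

hasMonoSol-schur⇒ : ∀ {k N χ} → HasMonoSol 0 (+ 1) N χ → HasMonoSol k (+ 1) N χ
hasMonoSol-schur⇒ {k} (x , y , z , w , rx , ry , rz , rw , e , cx , cy , cz) =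
  x , y , w , w , rx , ry , rw , rw ,
  from (E⇔ℕ k 1 x y w w) (schur-solution k {x} {y} (to (schur⇔ x y z w) e)) , cx , cy , refl

hasMonoSol⇒schur : ∀ {k N χ} → N + N ≤ k → HasMonoSol k (+ 1) N χ → HasMonoSol 0 (+ 1) N χ
hasMonoSol⇒schur {k} {N} 2N≤k
  (x , y , z , w , rx@(_ , x≤N) , ry@(_ , y≤N) , rz , rw@(1≤w , w≤N) , e , cs) =
  x , y , z , w , rx , ry , rz , rw , from (schur⇔ x y z w) x+y≡w , cs
  where
  x+y≤k : x + y ≤ k
  x+y≤k = ≤-trans (+-mono-≤ x≤N y≤N) 2N≤k
  w<k : w < k
  w<k = ≤-trans (m<m+n w 1≤w) (≤-trans (+-mono-≤ w≤N w≤N) 2N≤k)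
  x+y≡w : x + y ≡ w
  x+y≡w = proj₂ (small-solution⇒schur {x = x} {y} {z} x+y≤k w<k (to (E⇔ℕ k 1 x y z w) e))

forces-schur⇒ : ∀ {k N} → Forces 0 (+ 1) N → Forces k (+ 1) N
forces-schur⇒ {k} F χ = hasMonoSol-schur⇒ {k} (F χ)

∃-inRange? : ∀ N {P : ℕ → Set} → (∀ x → Dec (P x)) → Dec (∃ λ x → InRange N x × P x)
∃-inRange? N P? = map′
  (λ { (x , x<1+N , 1≤x , p) → x , (1≤x , ≤-pred x<1+N) , p })
  (λ { (x , (1≤x , x≤N) , p) → x , s≤s x≤N , 1≤x , p })
  (anyUpTo? (λ x → 1 ≤? x ×-dec P? x) (suc N))

hasMonoSol? : ∀ k j N χ → Dec (HasMonoSol k j N χ)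
hasMonoSol? k j N χ = map′
  (λ { (x , rx , y , ry , z , rz , w , rw , s) → x , y , z , w , rx , ry , rz , rw , s })
  (λ { (x , y , z , w , rx , ry , rz , rw , s) → x , rx , y , ry , z , rz , w , rw , s })
  (∃-inRange? N λ x → ∃-inRange? N λ y → ∃-inRange? N λ z → ∃-inRange? N λ w →
    (+ x +ℤ + y +ℤ + k *ℤ + z ≟ℤ (+ k +ℤ j) *ℤ + w) ×-dec
    (χ x ≟ᵇ χ w) ×-dec (χ y ≟ᵇ χ w) ×-dec (χ z ≟ᵇ χ w))

∀-vec? : ∀ {n} {P : Vec Bool n → Set} → (∀ v → Dec (P v)) → Dec (∀ v → P v)
∀-vec? {zero} P? = map′ (λ { p [] → p }) (λ p → p []) (P? [])
∀-vec? {suc n} P? = map′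
  (λ { (p , q) (true ∷ v) → p v ; (p , q) (false ∷ v) → q v })
  (λ p → p ∘ (true ∷_) , p ∘ (false ∷_))
  (∀-vec? (P? ∘ (true ∷_)) ×-dec ∀-vec? (P? ∘ (false ∷_)))

vecColoring : ∀ {n} → Vec Bool n → Coloring
vecColoring (b ∷ _)  1             = b
vecColoring (_ ∷ bs) (suc (suc x)) = vecColoring bs (suc x)
vecColoring _        _             = false

restriction : Coloring → ∀ n → Vec Bool n
restriction χ zero    = []
restriction χ (suc n) = χ 1 ∷ restriction (χ ∘ suc) n

vecColoring-restriction : ∀ {χ} n {x} → InRange n x → vecColoring (restriction χ n) x ≡ χ x
vecColoring-restriction zero    (1≤x , x≤0)           = contradiction x≤0 (<⇒≱ 1≤x)
vecColoring-restriction (suc n) {1}           _       = refl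
vecColoring-restriction (suc n) {suc (suc x)} (_ , s≤s x≤n) =
  vecColoring-restriction n (s≤s z≤n , x≤n)

forces? : ∀ k j N → Dec (Forces k j N)
forces? k j N = map′
  (λ mono χ → hasMonoSol-local {k} {j} (vecColoring-restriction N) (mono (restriction χ N)))
  (λ F v → F (vecColoring v))
  (∀-vec? λ v → hasMonoSol? k j N (vecColoring v))

schur : Forces 0 (+ 1) 5
schur = from-yes (forces? 0 (+ 1) 5)

χ[13∣2] : Coloring
χ[13∣2] 2 = false
χ[13∣2] _ = true

χ[14∣23] : Coloring
χ[14∣23] 2 = false
χ[14∣23] 3 = false
χ[14∣23] _ = true

forces-small : ∀ k → 1 ≤ k → k ≤ 3 → Forces k (+ 1) 4
forces-small 0 () _
forces-small 1 _ _ = from-yes (forces? 1 (+ 1) 4)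
forces-small 2 _ _ = from-yes (forces? 2 (+ 1) 4)
forces-small 3 _ _ = from-yes (forces? 3 (+ 1) 4)
forces-small (suc (suc (suc (suc _)))) _ (s≤s (s≤s (s≤s ())))

¬hasMonoSol-χ[13∣2] : ∀ k → k ≤ 3 → ¬ HasMonoSol k (+ 1) 3 χ[13∣2]
¬hasMonoSol-χ[13∣2] 0 _ = from-no (hasMonoSol? 0 (+ 1) 3 χ[13∣2])
¬hasMonoSol-χ[13∣2] 1 _ = from-no (hasMonoSol? 1 (+ 1) 3 χ[13∣2])
¬hasMonoSol-χ[13∣2] 2 _ = from-no (hasMonoSol? 2 (+ 1) 3 χ[13∣2])
¬hasMonoSol-χ[13∣2] 3 _ = from-no (hasMonoSol? 3 (+ 1) 3 χ[13∣2])
¬hasMonoSol-χ[13∣2] (suc (suc (suc (suc _)))) (s≤s (s≤s (s≤s ())))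

¬hasMonoSol-χ[14∣23] : ∀ k → 4 ≤ k → ¬ HasMonoSol k (+ 1) 4 χ[14∣23]
¬hasMonoSol-χ[14∣23] 4 _ = from-no (hasMonoSol? 4 (+ 1) 4 χ[14∣23])
¬hasMonoSol-χ[14∣23] 5 _ = from-no (hasMonoSol? 5 (+ 1) 4 χ[14∣23])
¬hasMonoSol-χ[14∣23] 6 _ = from-no (hasMonoSol? 6 (+ 1) 4 χ[14∣23])
¬hasMonoSol-χ[14∣23] 7 _ = from-no (hasMonoSol? 7 (+ 1) 4 χ[14∣23])
¬hasMonoSol-χ[14∣23] k@(suc (suc (suc (suc (suc (suc (suc (suc m)))))))) _ =
  from-no (hasMonoSol? 0 (+ 1) 4 χ[14∣23]) ∘ hasMonoSol⇒schur {k} (m≤m+n 8 m)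
¬hasMonoSol-χ[14∣23] 0 ()
¬hasMonoSol-χ[14∣23] 1 (s≤s ())
¬hasMonoSol-χ[14∣23] 2 (s≤s (s≤s ()))
¬hasMonoSol-χ[14∣23] 3 (s≤s (s≤s (s≤s ())))

theorem4 : (k : ℕ) → 1 ≤ k →
    (k ≤ 3 → IsRR k (+ 1) 4) × (4 ≤ k → IsRR k (+ 1) 5)
theorem4 k 1≤k =
  (λ k≤3 → isRR-intro {k} {+ 1} {3} (forces-small k 1≤k k≤3)
                                    (λ F → ¬hasMonoSol-χ[13∣2] k k≤3 (F χ[13∣2]))) ,
  (λ 4≤k → isRR-intro {k} {+ 1} {4} (forces-schur⇒ {k} schur)
                                    (λ F → ¬hasMonoSol-χ[14∣23] k 4≤k (F χ[14∣23])))
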